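{- If $1\leq r\leq n$ and $0\leq l\leq n-r$, then $D_r(\mathcal T_n)=\{f\in\mathcal T_n : \operatorname{rank}(f)=r\}$ contains (as a subsemigroup) an $r^l\times\pi_r(n-l)$ rectangular band.
   Context: $\mathcal T_n$ is the full transformation semigroup on $\{1,\dots,n\}$; the rank of a transformation is the size of its image. A $p\times q$ rectangular band is a semigroup isomorphic to $P\times Q$ with $|P|=p$, $|Q|=q$ and $(p_1,q_1)(p_2,q_2)=(p_1,q_2)$. For $1\leq r\leq m$, $\pi_r(m)$ is the maximum of $s_1\cdots s_r$ over all $r$-tuples of positive integers with $s_1+\cdots+s_r=m$. -}

module Defs where

open import Data.Nat using (ℕ; _≤_; _<_; _^_; _∸_)
open import Data.Fin using (Fin)
open import Data.Fin.Properties using (any?) renaming (_≟_ to _≟ᶠ_)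
open import Data.List using (List; length; filter)
open import Data.Vec using (Vec; sum; foldr′)
open import Data.Nat using (_*_)
open import Data.Vec.Relation.Unary.All using (All)
open import Data.Product using (Σ; ∃; _×_; _,_)
open import Relation.Binary.PropositionalEquality using (_≡_)
import Data.List as L

Trans : ℕ → Set
Trans n = Fin n → Fin n

-- Composition in the semigroup-theoretic (left-to-right) convention:
-- x (f ∘ₜ g) = (x f) g, i.e. first f, then g.
_∘ₜ_ : ∀ {n} → Trans n → Trans n → Trans n
(f ∘ₜ g) x = g (f x)

_≗ₜ_ : ∀ {n} → Trans n → Trans n → Set
f ≗ₜ g = ∀ x → f x ≡ g x

rank : ∀ {n} → Trans n → ℕ
rank {n} f = length (filter (λ y → any? (λ x → f x ≟ᶠ y)) (L.allFin n))

product : ∀ {k} → Vec ℕ k → ℕ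
product = foldr′ _*_ 1

-- π_r(m) = p: p is the maximum of s₁⋯s_r over r-tuples of positive
-- integers with s₁+⋯+s_r = m (stated relationally: attained and maximal).
IsPi : ℕ → ℕ → ℕ → Set
IsPi r m p =
  (Σ (Vec ℕ r) λ s → All (λ sᵢ → 1 ≤ sᵢ) s × sum s ≡ m × product s ≡ p)
  × (∀ (s : Vec ℕ r) → All (λ sᵢ → 1 ≤ sᵢ) s → sum s ≡ m → product s ≤ p)

-- D_r(T_n) contains (as a subsemigroup) a p × q rectangular band:
-- there is an injective map e : Fin p × Fin q → T_n with every e(i,j) of
-- rank r and e(i,j) e(i',j') = e(i,j').  (Its image is then a subsemigroup
-- of D_r(T_n) isomorphic to the p × q rectangular band.)
HasRectBand : (n r p q : ℕ) → Set
HasRectBand n r p q =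
  Σ (Fin p → Fin q → Trans n) λ e →
    (∀ i j → rank (e i j) ≡ r)
    × (∀ i j i′ j′ → (e i j ∘ₜ e i′ j′) ≗ₜ e i j′)
    × (∀ i j i′ j′ → e i j ≗ₜ e i′ j′ → (i ≡ i′ × j ≡ j′))

-- Write m = n − l and pick block sizes s₁,…,s_r ≥ 1 with s₁ + ⋯ + s_r = m and
-- s₁⋯s_r = π_r(m). Split {1,…,n} into l free points and r blocks of these sizes.
-- A map u from the free points to {1,…,r} (r^l choices) gives κ_u : n → r,
-- sending a free point x to u(x) and a block point to its block; a transversal t
-- of the blocks (s₁⋯s_r choices) gives ι_t : r → n. Since κ_u ι_t = id for all
-- u, t, the maps e(u,t) = κ_u ι_t have rank r and multiply as a rectangular band.
module Submission where

open import Defs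
open import Data.Nat using (ℕ; _≤_; _^_; _∸_; _+_)
import Data.Nat as ℕ
open import Data.Nat.Properties using (m+[n∸m]≡n; ≤-trans; m∸n≤m)
open import Data.Fin using (Fin; zero; suc; splitAt; remQuot; combine; finToFun; _↑ˡ_; _↑ʳ_)
open import Data.Fin.Properties
  using (any?; splitAt-↑ˡ; splitAt-↑ʳ; ↑ˡ-injective; ↑ʳ-injective; combine-remQuot)
  renaming (_≟_ to _≟ᶠ_)
open import Data.Vec using (Vec; []; _∷_; sum)
open import Data.List using (List; length; filter; map; allFin)
open import Data.List.Properties using (length-map; length-tabulate)
open import Data.List.Membership.Propositional using (_∈_)
open import Data.List.Membership.Propositional.Properties
  using (∈-filter⁺; ∈-filter⁻; ∈-allFin; ∈-map⁺; ∈-map⁻)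
open import Data.List.Membership.Propositional.Properties.WithK using (unique∧set⇒bag)
open import Data.List.Relation.Unary.Unique.Propositional using (Unique)
open import Data.List.Relation.Unary.Unique.Propositional.Properties
  using (filter⁺; allFin⁺; map⁺)
open import Data.List.Relation.Binary.BagAndSetEquality using (∼bag⇒↭)
open import Data.List.Relation.Binary.Permutation.Propositional.Properties using (↭-length)
open import Data.Product using (∃; _×_; _,_; proj₁; proj₂; uncurry)
open import Data.Product.Properties using (×-≡,≡→≡)
open import Data.Sum using ([_,_]′)
open import Function using (_∘_; Injective; _⇔_; mk⇔)
open import Relation.Binary.PropositionalEquality
open import Relation.Unary using (Decidable)

image≈injection⇒rank≡ : ∀ {n r} (f : Trans n) (ι : Fin r → Fin n) → Injective _≡_ _≡_ ι →
  (∀ y → ∃ (λ x → f x ≡ y) → ∃ (λ a → ι a ≡ y)) →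
  (∀ a → ∃ (λ x → f x ≡ ι a)) →
  rank f ≡ r
image≈injection⇒rank≡ {n} {r} f ι ι-inj im⊆ ι⊆im = begin
  length image               ≡⟨ ↭-length (∼bag⇒↭ (unique∧set⇒bag image-unique ι-unique
                                                                  (mk⇔ image⊆ι ι⊆image))) ⟩
  length (map ι (allFin r))  ≡⟨ length-map ι (allFin r) ⟩
  length (allFin r)          ≡⟨ length-tabulate (λ a → a) ⟩
  r                          ∎
  where
  open ≡-Reasoning

  inImage? : Decidable (λ y → ∃ λ x → f x ≡ y)
  inImage? y = any? (λ x → f x ≟ᶠ y)

  image : List (Fin n)
  image = filter inImage? (allFin n)

  image-unique : Unique image
  image-unique = filter⁺ inImage? (allFin⁺ n)

  ι-unique : Unique (map ι (allFin r))
  ι-unique = map⁺ ι-inj (allFin⁺ r)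

  image⊆ι : ∀ {y} → y ∈ image → y ∈ map ι (allFin r)
  image⊆ι {y} y∈image with a , refl ← im⊆ y (proj₂ (∈-filter⁻ inImage? {xs = allFin n} y∈image))
    = ∈-map⁺ ι (∈-allFin a)

  ι⊆image : ∀ {y} → y ∈ map ι (allFin r) → y ∈ image
  ι⊆image y∈ι with a , _ , refl ← ∈-map⁻ ι y∈ι = ∈-filter⁺ inImage? (∈-allFin (ι a)) (ι⊆im a)

rank-retraction : ∀ {n r} (κ : Fin n → Fin r) (ι : Fin r → Fin n) →
  (∀ a → κ (ι a) ≡ a) → rank (ι ∘ κ) ≡ r
rank-retraction κ ι κι≡id = image≈injection⇒rank≡ (ι ∘ κ) ι ι-injective
  (λ y (x , ικx≡y) → κ x , ικx≡y)
  (λ a → ι a , cong ι (κι≡id a))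
  where
  ι-injective : Injective _≡_ _≡_ ι
  ι-injective {a} {b} ιa≡ιb = trans (sym (κι≡id a)) (trans (cong κ ιa≡ιb) (κι≡id b))

sections⇒HasRectBand : ∀ {n r p q} (κ : Fin p → Fin n → Fin r) (ι : Fin q → Fin r → Fin n) →
  (∀ i j a → κ i (ι j a) ≡ a) →
  (∀ i i′ → (∀ x → κ i x ≡ κ i′ x) → i ≡ i′) →
  (∀ j j′ → (∀ a → ι j a ≡ ι j′ a) → j ≡ j′) →
  HasRectBand n r p q
sections⇒HasRectBand {n} {r} {p} {q} κ ι κι≡id κ-injective ι-injective =
  e , (λ i j → rank-retraction (κ i) (ι j) (κι≡id i j)) , e-rectangular , e-injective
  where
  e : Fin p → Fin q → Trans n
  e i j = ι j ∘ κ i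

  e-rectangular : ∀ i j i′ j′ → (e i j ∘ₜ e i′ j′) ≗ₜ e i j′
  e-rectangular i j i′ j′ x = cong (ι j′) (κι≡id i′ j (κ i x))

  e-injective : ∀ i j i′ j′ → e i j ≗ₜ e i′ j′ → i ≡ i′ × j ≡ j′
  e-injective i j i′ j′ e≗e′ = κ-injective i i′ κ≗κ′ , ι-injective j j′ ι≗ι′
    where
    κ≗κ′ : ∀ x → κ i x ≡ κ i′ x
    κ≗κ′ x = begin
      κ i x                ≡⟨ sym (κι≡id i j (κ i x)) ⟩
      κ i (e i j x)        ≡⟨ cong (κ i) (e≗e′ x) ⟩
      κ i (ι j′ (κ i′ x))  ≡⟨ κι≡id i j′ (κ i′ x) ⟩
      κ i′ x               ∎
      where open ≡-Reasoning
    ι≗ι′ : ∀ a → ι j a ≡ ι j′ a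
    ι≗ι′ a = begin
      ι j a                ≡⟨ cong (ι j) (κι≡id i j a) ⟨
      e i j (ι j a)        ≡⟨ e≗e′ (ι j a) ⟩
      ι j′ (κ i′ (ι j a))  ≡⟨ cong (ι j′) (κι≡id i′ j a) ⟩
      ι j′ a               ∎
      where open ≡-Reasoning

remQuot-injective : ∀ {m} n → Injective _≡_ _≡_ (remQuot {m} n)
remQuot-injective {m} n {i} {i′} eq = begin
  i                                  ≡⟨ combine-remQuot {m} n i ⟨
  uncurry combine (remQuot {m} n i)  ≡⟨ cong (uncurry combine) eq ⟩
  uncurry combine (remQuot {m} n i′) ≡⟨ combine-remQuot {m} n i′ ⟩
  i′                                 ∎
  where open ≡-Reasoning

finToFun-injective : ∀ {r} l (i i′ : Fin (r ^ l)) →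
  (∀ t → finToFun {r} {l} i t ≡ finToFun i′ t) → i ≡ i′
finToFun-injective ℕ.zero    zero zero _ = refl
finToFun-injective {r} (ℕ.suc l) i  i′   h = remQuot-injective (r ^ l)
  (×-≡,≡→≡ (h zero , finToFun-injective l _ _ (h ∘ suc)))

blockOf : ∀ {r} (s : Vec ℕ r) → Fin (sum s) → Fin r
blockOf (s₀ ∷ s) x = [ (λ _ → zero) , suc ∘ blockOf s ]′ (splitAt s₀ x)

-- The mixed-radix digits of j select one point from each block.
transversal : ∀ {r} (s : Vec ℕ r) → Fin (product s) → Fin r → Fin (sum s)
transversal (s₀ ∷ s) j zero    = proj₁ (remQuot {s₀} (product s) j) ↑ˡ sum s
transversal (s₀ ∷ s) j (suc a) = s₀ ↑ʳ transversal s (proj₂ (remQuot {s₀} (product s) j)) a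

blockOf-transversal : ∀ {r} (s : Vec ℕ r) j a → blockOf s (transversal s j a) ≡ a
blockOf-transversal (s₀ ∷ s) j zero
  rewrite splitAt-↑ˡ s₀ (proj₁ (remQuot {s₀} (product s) j)) (sum s) = refl
blockOf-transversal (s₀ ∷ s) j (suc a)
  rewrite splitAt-↑ʳ s₀ (sum s) (transversal s (proj₂ (remQuot {s₀} (product s) j)) a) =
  cong suc (blockOf-transversal s (proj₂ (remQuot {s₀} (product s) j)) a)

transversal-injective : ∀ {r} (s : Vec ℕ r) j j′ →
  (∀ a → transversal s j a ≡ transversal s j′ a) → j ≡ j′
transversal-injective []       zero zero _ = refl
transversal-injective (s₀ ∷ s) j    j′   h = remQuot-injective (product s)
  (×-≡,≡→≡ ( ↑ˡ-injective (sum s) _ _ (h zero)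
           , transversal-injective s _ _ (↑ʳ-injective s₀ _ _ ∘ h ∘ suc)))

hasRectBand-freePoints+blocks : ∀ {r} l (s : Vec ℕ r) →
  HasRectBand (l + sum s) r (r ^ l) (product s)
hasRectBand-freePoints+blocks {r} l s =
  sections⇒HasRectBand κ ι κι≡id κ-injective ι-injective
  where
  κ : Fin (r ^ l) → Fin (l + sum s) → Fin r
  κ i x = [ finToFun i , blockOf s ]′ (splitAt l x)

  ι : Fin (product s) → Fin r → Fin (l + sum s)
  ι j a = l ↑ʳ transversal s j a

  κι≡id : ∀ i j a → κ i (ι j a) ≡ a
  κι≡id i j a = trans (cong [ finToFun i , blockOf s ]′ (splitAt-↑ʳ l (sum s) (transversal s j a)))
                      (blockOf-transversal s j a)

  κ-free : ∀ i t → κ i (t ↑ˡ sum s) ≡ finToFun {r} {l} i t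
  κ-free i t = cong [ finToFun i , blockOf s ]′ (splitAt-↑ˡ l t (sum s))

  κ-injective : ∀ i i′ → (∀ x → κ i x ≡ κ i′ x) → i ≡ i′
  κ-injective i i′ h = finToFun-injective l i i′
    (λ t → trans (sym (κ-free i t)) (trans (h (t ↑ˡ sum s)) (κ-free i′ t)))

  ι-injective : ∀ j j′ → (∀ a → ι j a ≡ ι j′ a) → j ≡ j′
  ι-injective j j′ h = transversal-injective s j j′ (↑ʳ-injective l _ _ ∘ h)

proposition3p7 : ∀ (n r l : ℕ) → 1 ≤ r → r ≤ n → l ≤ n ∸ r →
    ∀ (p : ℕ) → IsPi r (n ∸ l) p → HasRectBand n r (r ^ l) p
proposition3p7 n r l _ _ l≤n∸r p ((s , _ , sum-s≡n∸l , product-s≡p) , _) =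
  subst₂ (λ n′ p′ → HasRectBand n′ r (r ^ l) p′) l+sum-s≡n product-s≡p
    (hasRectBand-freePoints+blocks l s)
  where
  l+sum-s≡n : l + sum s ≡ n
  l+sum-s≡n = trans (cong (l +_) sum-s≡n∸l) (m+[n∸m]≡n (≤-trans l≤n∸r (m∸n≤m n r)))
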